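{- For each integer $\ell\ge3$ and each nonnegative integer $j$, $$\mathfrak{K}_j(3\cdot2^{\ell-2}+1)>\frac{5\cdot2^{2\ell-3}-j}{3\cdot2^{\ell-2}+1}\qquad\text{and}\qquad \mathfrak{K}_j(2^{\ell-1}+3)>\frac{2^{2\ell-2}-j}{2^{\ell-1}+3}.$$
   Context: The Thue–Morse word $\mathbf{t}=\mathbf{t}_1\mathbf{t}_2\mathbf{t}_3\cdots=0110100110010110\cdots$ is the infinite binary word whose $i$-th letter $\mathbf{t}_i$ ($i\ge 1$) is the parity of the number of 1's in the binary expansion of $i-1$. A $k$-anti-power is a word $w^{(1)}\cdots w^{(k)}$ with $w^{(1)},\dots,w^{(k)}$ pairwise distinct words of the same length. For $j\ge0$, the $j$-fix of $\mathbf{t}$ of length $N$ is $\mathbf{t}_{j+1}\cdots\mathbf{t}_{j+N}$. For a positive integer $m$, $\mathfrak{K}_j(m)$ is the smallest positive integer $k$ such that the $j$-fix of $\mathbf{t}$ of length $km$ is not a $k$-anti-power. -}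

module Defs where

open import Data.Nat using (ℕ; zero; suc; _+_; _*_; _<_; _%_; _/_; _≡ᵇ_)
open import Data.Bool using (Bool; true; false; _xor_)
open import Data.Vec using (Vec; tabulate)
open import Data.Fin using (Fin; toℕ)
open import Relation.Binary.PropositionalEquality using (_≡_; _≢_)
open import Relation.Nullary using (¬_)
open import Data.Product using (_×_)

-- parity of the number of 1's in the binary expansion of n, computed with
-- fuel f (fuel n is enough for n, since n / 2 < n for n > 0)
bitParity : ℕ → ℕ → Bool
bitParity zero    n = false
bitParity (suc f) n = (n % 2 ≡ᵇ 1) xor bitParity f (n / 2)

-- Thue–Morse, 0-indexed: tm i = t_{i+1} = parity of the number of 1's of i
tm : ℕ → Bool
tm n = bitParity n n

-- the b-th block (b = 0,1,...) of length m of the j-fix of t: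
-- t_{j+bm+1} ... t_{j+bm+m}
block : (j m b : ℕ) → Vec Bool m
block j m b = tabulate (λ (p : Fin m) → tm (j + b * m + toℕ p))

IsAntiPower : (j m k : ℕ) → Set
IsAntiPower j m k = ∀ a b → a < k → b < k → a ≢ b → block j m a ≢ block j m b

-- k = 𝔎_j(m): smallest positive k such that the j-fix of length km
-- is not a k-anti-power
IsFrakK : (j m k : ℕ) → Set
IsFrakK j m k =
  (0 < k) × (¬ IsAntiPower j m k) × (∀ k' → 0 < k' → k' < k → IsAntiPower j m k')

-- Write N = 2^(ℓ-2). If the j-fix of length k·m is not a k-anti-power, two of
-- its blocks coincide, i.e. a factor of t of length m recurs at a distance
-- d·m, d ≥ 1, inside the prefix of length k·m + j. So it suffices to show
-- that no such repetition fits into the prefix of length B, where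
-- (m, B) = (3N + 1, 10N²) resp. (2N + 3, 4N²)  (frakK-bound).
--
-- Repetitions are excluded by desubstitution: since t is the fixed point of
-- 0 ↦ 01, 1 ↦ 10, an agreement of length L ≥ 4 at distance D forces D even
-- and halves to an agreement of length about L/2 at distance D/2 (halve).
-- As m is odd, log₂ N halvings show N ∣ d and leave an agreement of length
-- 4, halved once more to 2 (resp. of length 3) at distance e·m with N·e = d
-- (iterate).
-- If e is large, or the shrunken position is large, the repetition does not
-- fit into B (far₁, late₁, far₂, late₂); otherwise the block structure
-- t(c·2^s + i) = t(c) xor t(i) rules the agreement out
-- (no-agreement-at-M+3, no-agreement-at-3N+1).

module Submission where

open import Data.Bool using (true; false; not; _xor_)
open import Data.Bool.Properties using (not-involutive; not-injective; not-¬)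
open import Data.Empty using (⊥; ⊥-elim)
open import Data.Fin using (Fin; fromℕ<)
open import Data.Fin.Properties using (toℕ-fromℕ<)
open import Data.Nat using (ℕ; zero; suc; _+_; _*_; _∸_; _^_; _<_; _≤_; z≤n; s≤s; _<?_; _%_; _/_; _≡ᵇ_)
open import Data.Nat.Divisibility using (divides)
open import Data.Nat.DivMod using (m*n%n≡0; m*n/n≡m; [m+kn]%n≡m%n; /-monoˡ-≤; m/n<m; +-distrib-/-∣ʳ)
open import Data.Nat.Properties
open import Data.Nat.Tactic.RingSolver using (solve-∀)
open import Data.Product using (Σ; _×_; _,_)
open import Data.Sum using (inj₁; inj₂)
open import Data.Vec using (lookup)
open import Data.Vec.Properties using (lookup∘tabulate)
open import Defs
open import Relation.Binary using (tri<; tri≈; tri>)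
open import Relation.Binary.PropositionalEquality
open import Relation.Nullary using (yes; no)

half≤ : ∀ f n → n ≤ suc f → n / 2 ≤ f
half≤ zero    n n≤1 = ≤-trans (/-monoˡ-≤ 2 n≤1) z≤n
half≤ (suc f) n n≤f = ≤-trans (/-monoˡ-≤ 2 n≤f) (≤-pred (m/n<m (suc (suc f)) 2 (s≤s (s≤s z≤n))))

bitParity-suc : ∀ f n → n ≤ f → bitParity (suc f) n ≡ bitParity f n
bitParity-suc zero    .zero z≤n = refl
bitParity-suc (suc f) n     n≤f = cong ((n % 2 ≡ᵇ 1) xor_) (bitParity-suc f (n / 2) (half≤ f n n≤f))

bitParity-tm : ∀ f n → n ≤ f → bitParity f n ≡ tm n
bitParity-tm f n n≤f = trans (cong (λ g → bitParity g n) (sym (m∸n+n≡m n≤f))) (extra (f ∸ n))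
  where
  extra : ∀ k → bitParity (k + n) n ≡ tm n
  extra zero    = refl
  extra (suc k) = trans (bitParity-suc (k + n) n (m≤n+m n k)) (extra k)

tm-even : ∀ a → tm (a * 2) ≡ tm a
tm-even zero    = refl
tm-even (suc a) = begin
  ((suc a * 2) % 2 ≡ᵇ 1) xor bitParity (suc (a * 2)) (suc a * 2 / 2)
    ≡⟨ cong₂ (λ r q → (r ≡ᵇ 1) xor bitParity (suc (a * 2)) q) (m*n%n≡0 (suc a) 2) (m*n/n≡m (suc a) 2) ⟩
  bitParity (suc (a * 2)) (suc a)
    ≡⟨ bitParity-tm (suc (a * 2)) (suc a) (s≤s (m≤m*n a 2)) ⟩
  tm (suc a) ∎
  where open ≡-Reasoning

tm-odd : ∀ a → tm (suc (a * 2)) ≡ not (tm a)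
tm-odd a = begin
  (suc (a * 2) % 2 ≡ᵇ 1) xor bitParity (a * 2) (suc (a * 2) / 2)
    ≡⟨ cong₂ (λ r q → (r ≡ᵇ 1) xor bitParity (a * 2) q) ([m+kn]%n≡m%n 1 a 2) half ⟩
  not (bitParity (a * 2) a)
    ≡⟨ cong not (bitParity-tm (a * 2) a (m≤m*n a 2)) ⟩
  not (tm a) ∎
  where
  open ≡-Reasoning
  half : suc (a * 2) / 2 ≡ a
  half = trans (+-distrib-/-∣ʳ 1 {d = 2} (divides a refl)) (m*n/n≡m a 2)

data Parity : ℕ → Set where
  even : ∀ a → Parity (a * 2)
  odd  : ∀ a → Parity (suc (a * 2))

parity : ∀ n → Parity n
parity zero = even 0
parity (suc n) with parity n
... | even a = odd a
... | odd a  = even (suc a)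

-- the library's even≢odd, with the factor 2 on the right as in the parity view
double≢odd : ∀ x y → x * 2 ≢ suc (y * 2)
double≢odd x y eq = even≢odd x y (trans (*-comm 2 x) (trans eq (cong suc (*-comm y 2))))

half-< : ∀ a N → a * 2 < 2 * N → a < N
half-< a N a*2<2N = *-cancelʳ-< 2 a N (≤-trans a*2<2N (≤-reflexive (*-comm 2 N)))

tm-pair : ∀ a → tm (a * 2) ≢ tm (suc (a * 2))
tm-pair a eq = not-¬ refl (trans (sym (tm-even a)) (trans eq (tm-odd a)))

-- t contains no cube of a letter xxx: one of the first two letters pairs
-- with its successor as (2a, 2a+1).
no-cube : ∀ b → tm b ≡ tm (suc b) → tm (suc b) ≡ tm (suc (suc b)) → ⊥
no-cube b eq₁ eq₂ with parity b
... | even a = tm-pair a eq₁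
... | odd a  = tm-pair (suc a) eq₂

tm-shift : ∀ s c i → i < 2 ^ s → tm (c * 2 ^ s + i) ≡ tm c xor tm i
tm-shift zero c zero _ = trans (cong tm (trans (+-identityʳ _) (*-identityʳ c))) (sym (xor-false (tm c)))
  where
  xor-false : ∀ x → x xor false ≡ x
  xor-false true  = refl
  xor-false false = refl
tm-shift zero c (suc i) (s≤s ())
tm-shift (suc s) c i i<2N with parity i
... | even a = begin
  tm (c * (2 * 2 ^ s) + a * 2) ≡⟨ cong tm (shift-even c (2 ^ s) a) ⟩
  tm ((c * 2 ^ s + a) * 2)     ≡⟨ tm-even (c * 2 ^ s + a) ⟩
  tm (c * 2 ^ s + a)           ≡⟨ tm-shift s c a (half-< a (2 ^ s) i<2N) ⟩
  tm c xor tm a                ≡⟨ cong (tm c xor_) (sym (tm-even a)) ⟩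
  tm c xor tm (a * 2)          ∎
  where
  open ≡-Reasoning
  shift-even : ∀ c N a → c * (2 * N) + a * 2 ≡ (c * N + a) * 2
  shift-even = solve-∀
... | odd a = begin
  tm (c * (2 * 2 ^ s) + suc (a * 2)) ≡⟨ cong tm (shift-odd c (2 ^ s) a) ⟩
  tm (suc ((c * 2 ^ s + a) * 2))     ≡⟨ tm-odd (c * 2 ^ s + a) ⟩
  not (tm (c * 2 ^ s + a))           ≡⟨ cong not (tm-shift s c a (half-< a (2 ^ s) (<⇒≤ i<2N))) ⟩
  not (tm c xor tm a)                ≡⟨ not-xor (tm c) (tm a) ⟩
  tm c xor not (tm a)                ≡⟨ cong (tm c xor_) (sym (tm-odd a)) ⟩
  tm c xor tm (suc (a * 2))          ∎
  where
  open ≡-Reasoning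
  shift-odd : ∀ c N a → c * (2 * N) + suc (a * 2) ≡ suc ((c * N + a) * 2)
  shift-odd = solve-∀
  not-xor : ∀ x y → not (x xor y) ≡ x xor not y
  not-xor true  y = refl
  not-xor false y = refl

Agree : ℕ → ℕ → ℕ → Set
Agree p q L = ∀ i → i < L → tm (i + p) ≡ tm (i + q)

agree-≤ : ∀ {p q L L′} → L′ ≤ L → Agree p q L → Agree p q L′
agree-≤ L′≤L agr i i<L′ = agr i (≤-trans i<L′ L′≤L)

agree-sym : ∀ {p q L} → Agree p q L → Agree q p L
agree-sym agr i i<L = sym (agr i i<L)

-- A factor of length 4 never occurs both at an even and at an odd position:
-- reading it in letter pairs would force a cube t(b) t(b+1) t(b+2).
no-even-odd-agreement : ∀ a b → Agree (a * 2) (suc (b * 2)) 4 → ⊥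
no-even-odd-agreement a b agr = no-cube b
  (trans (sym (not-involutive (tm b))) (trans (cong not (sym pos₀)) pos₁))
  (trans (sym (not-involutive (tm (suc b)))) (trans (cong not (sym pos₂)) pos₃))
  where
  pos₀ : tm a ≡ not (tm b)
  pos₀ = trans (sym (tm-even a)) (trans (agr 0 (s≤s z≤n)) (tm-odd b))
  pos₁ : not (tm a) ≡ tm (suc b)
  pos₁ = trans (sym (tm-odd a)) (trans (agr 1 (s≤s (s≤s z≤n))) (tm-even (suc b)))
  pos₂ : tm (suc a) ≡ not (tm (suc b))
  pos₂ = trans (sym (tm-even (suc a))) (trans (agr 2 (s≤s (s≤s (s≤s z≤n)))) (tm-odd (suc b)))
  pos₃ : not (tm (suc a)) ≡ tm (suc (suc b))
  pos₃ = trans (sym (tm-odd (suc a))) (trans (agr 3 (s≤s (s≤s (s≤s (s≤s z≤n))))) (tm-even (suc (suc b))))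

tm-double : ∀ i x → tm (i * 2 + x * 2) ≡ tm (i + x)
tm-double i x = trans (cong tm (sym (*-distribʳ-+ 2 i x))) (tm-even (i + x))

tm-double+1 : ∀ i x → tm (i * 2 + suc (x * 2)) ≡ not (tm (i + x))
tm-double+1 i x = trans (cong tm (trans (+-suc (i * 2) (x * 2)) (cong suc (sym (*-distribʳ-+ 2 i x))))) (tm-odd (i + x))

-- index i of a factor of length K is read at index 2i of one of length 2K - 1
double-index : ∀ {i K L} → i < K → K * 2 ≤ suc L → i * 2 < L
double-index i<K K*2≤1+L = ≤-pred (≤-trans (*-monoˡ-≤ 2 i<K) K*2≤1+L)

-- Desubstitution. An agreement of length L ≥ 4 at distance D forces D to be
-- even, and the preimages under 0 ↦ 01, 1 ↦ 10 agree on half the length,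
-- at half the distance, starting at ⌊p/2⌋.
halve : ∀ {L K} p D → 4 ≤ L → K * 2 ≤ suc L → Agree p (p + D) L →
  Σ ℕ λ a → Σ ℕ λ D′ → D ≡ D′ * 2 × a * 2 ≤ p × Agree a (a + D′) K
halve p D 4≤L K*2≤1+L agr with parity D | parity p
... | odd D′  | even a = ⊥-elim (no-even-odd-agreement a (a + D′)
      (subst (λ q → Agree (a * 2) q 4) (even+odd a D′) (agree-≤ 4≤L agr)))
  where
  even+odd : ∀ a D′ → a * 2 + suc (D′ * 2) ≡ suc ((a + D′) * 2)
  even+odd = solve-∀
... | odd D′  | odd a  = ⊥-elim (no-even-odd-agreement (suc (a + D′)) a
      (agree-sym (subst (λ q → Agree (suc (a * 2)) q 4) (odd+odd a D′) (agree-≤ 4≤L agr))))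
  where
  odd+odd : ∀ a D′ → suc (a * 2) + suc (D′ * 2) ≡ suc (a + D′) * 2
  odd+odd = solve-∀
... | even D′ | even a = a , D′ , refl , ≤-refl , λ i i<K → begin
  tm (i + a)                    ≡⟨ sym (tm-double i a) ⟩
  tm (i * 2 + a * 2)            ≡⟨ agr (i * 2) (double-index i<K K*2≤1+L) ⟩
  tm (i * 2 + (a * 2 + D′ * 2)) ≡⟨ cong (λ q → tm (i * 2 + q)) (sym (*-distribʳ-+ 2 a D′)) ⟩
  tm (i * 2 + (a + D′) * 2)     ≡⟨ tm-double i (a + D′) ⟩
  tm (i + (a + D′))             ∎
  where
  open ≡-Reasoning
... | even D′ | odd a  = a , D′ , refl , n≤1+n _ , λ i i<K → not-injective (begin
  not (tm (i + a))                   ≡⟨ sym (tm-double+1 i a) ⟩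
  tm (i * 2 + suc (a * 2))           ≡⟨ agr (i * 2) (double-index i<K K*2≤1+L) ⟩
  tm (i * 2 + suc (a * 2 + D′ * 2))  ≡⟨ cong (λ q → tm (i * 2 + suc q)) (sym (*-distribʳ-+ 2 a D′)) ⟩
  tm (i * 2 + suc ((a + D′) * 2))    ≡⟨ tm-double+1 i (a + D′) ⟩
  not (tm (i + (a + D′)))            ∎)
  where
  open ≡-Reasoning

odd-factor : ∀ d m′ D′ → d * suc (m′ * 2) ≡ D′ * 2 →
  Σ ℕ λ d′ → d ≡ d′ * 2 × D′ ≡ d′ * suc (m′ * 2)
odd-factor d m′ D′ eq with parity d
... | even d′ = d′ , refl , sym (*-cancelʳ-≡ (d′ * suc (m′ * 2)) D′ 2 (trans (swap d′ (suc (m′ * 2))) eq))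
  where
  swap : ∀ x y → x * y * 2 ≡ x * 2 * y
  swap = solve-∀
... | odd d′  = ⊥-elim (double≢odd D′ (d′ + m′ + d′ * m′ * 2) (trans (sym eq) (odd*odd d′ m′)))
  where
  odd*odd : ∀ x y → suc (x * 2) * suc (y * 2) ≡ suc ((x + y + x * y * 2) * 2)
  odd*odd = solve-∀

halve-multiple : ∀ {L K} p d m′ → 4 ≤ L → K * 2 ≤ suc L → Agree p (p + d * suc (m′ * 2)) L →
  Σ ℕ λ a → Σ ℕ λ d′ → d ≡ d′ * 2 × a * 2 ≤ p × Agree a (a + d′ * suc (m′ * 2)) K
halve-multiple {K = K} p d m′ 4≤L K*2≤1+L agr with halve p (d * suc (m′ * 2)) 4≤L K*2≤1+L agr
... | a , D′ , dm≡D′*2 , a*2≤p , agr′ with odd-factor d m′ D′ dm≡D′*2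
...   | d′ , d≡d′*2 , D′≡d′m = a , d′ , d≡d′*2 , a*2≤p , subst (λ D → Agree a (a + D) K) D′≡d′m agr′

iterate : ∀ s {c} → 2 ≤ c → ∀ p d m′ → Agree p (p + d * suc (m′ * 2)) (2 ^ s * c + 1) →
  Σ ℕ λ P → Σ ℕ λ e → d ≡ 2 ^ s * e × 2 ^ s * P ≤ p × Agree P (P + e * suc (m′ * 2)) (c + 1)
iterate zero {c} _ p d m′ agr =
  p , d , sym (*-identityˡ d) , ≤-reflexive (*-identityˡ p) ,
  agree-≤ (≤-reflexive (cong (_+ 1) (sym (*-identityˡ c)))) agr
iterate (suc s) {c} 2≤c p d m′ agr
  with halve-multiple p d m′ 4≤L (≤-reflexive (halved-length (2 ^ s) c)) agr
  where
  N : ℕ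
  N = 2 ^ s
  halved-length : ∀ N c → (N * c + 1) * 2 ≡ suc (2 * N * c + 1)
  halved-length = solve-∀
  4≤L : 4 ≤ 2 * N * c + 1
  4≤L = ≤-trans (m≤m+n 4 1) (+-monoˡ-≤ 1 (*-mono-≤ (*-monoʳ-≤ 2 (m^n>0 2 s)) 2≤c))
... | a , d′ , d≡d′*2 , a*2≤p , agr′ with iterate s 2≤c a d′ m′ agr′
...   | P , e , d′≡Ne , NP≤a , agr″ = P , e , d-splits , NP-bound , agr″
  where
  N : ℕ
  N = 2 ^ s
  reassoc : ∀ N x → N * x * 2 ≡ 2 * N * x
  reassoc = solve-∀
  d-splits : d ≡ 2 * N * e
  d-splits = trans d≡d′*2 (trans (cong (_* 2) d′≡Ne) (reassoc N e))
  NP-bound : 2 * N * P ≤ p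
  NP-bound = ≤-trans (≤-reflexive (sym (reassoc N P))) (≤-trans (*-monoˡ-≤ 2 NP≤a) a*2≤p)

-- t has no factor of length 6 of the form w w̄ with |w| = 3 (w̄ the
-- complement of w): reading it in letter pairs forces a cube.
no-complemented-square : ∀ x →
  tm x ≡ not (tm (3 + x)) → tm (1 + x) ≡ not (tm (4 + x)) → tm (2 + x) ≡ not (tm (5 + x)) → ⊥
no-complemented-square x eq₀ eq₁ eq₂ with parity x
... | even a = no-cube a first second
  where
  first : tm a ≡ tm (suc a)
  first = trans (sym (tm-even a)) (trans eq₀ (trans (cong not (tm-odd (suc a))) (not-involutive _)))
  second : tm (suc a) ≡ tm (suc (suc a))
  second = trans (sym first) (not-injective (trans (sym (tm-odd a)) (trans eq₁ (cong not (tm-even (suc (suc a)))))))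
... | odd a  = no-cube (suc a) first second
  where
  first : tm (suc a) ≡ tm (suc (suc a))
  first = trans (sym (tm-even (suc a))) (trans eq₁ (trans (cong not (tm-odd (suc (suc a)))) (not-involutive _)))
  second : tm (suc (suc a)) ≡ tm (suc (suc (suc a)))
  second = trans (sym first) (not-injective (trans (sym (tm-odd (suc a))) (trans eq₂ (cong not (tm-even (suc (suc (suc a))))))))

-- For M = 2^s and P + 6 ≤ M, the factor of length 3 at P does not recur at
-- distance M + 3: block 1 of length M is the complement of block 0, so the
-- recurrence would be a complemented square at P inside block 0.
no-agreement-at-M+3 : ∀ s P → P + 6 ≤ 2 ^ s → Agree P (P + (2 ^ s + 3)) 3 → ⊥
no-agreement-at-M+3 s P P+6≤M agr =
  no-complemented-square P (complemented 0 z≤n) (complemented 1 (s≤s z≤n)) (complemented 2 (s≤s (s≤s z≤n)))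
  where
  move : ∀ r P M → r + (P + (M + 3)) ≡ 1 * M + (3 + (r + P))
  move = solve-∀
  complemented : ∀ r → r ≤ 2 → tm (r + P) ≡ not (tm (3 + (r + P)))
  complemented r r≤2 = trans (agr r (s≤s r≤2)) (trans (cong tm (move r P (2 ^ s))) (tm-shift s 1 (3 + (r + P)) in-block))
    where
    in-block : 3 + (r + P) < 2 ^ s
    in-block = ≤-trans (+-monoʳ-≤ 4 (+-monoˡ-≤ P r≤2)) (≤-trans (≤-reflexive (+-comm 6 P)) P+6≤M)

-- P + 2 = N: then P is even, so t(P) ≠ t(P+1).
before-N : ∀ s P → suc (suc P) ≡ 2 ^ suc s → tm P ≢ tm (suc P)
before-N s P P+2≡N with parity P
... | even x = tm-pair x
... | odd x  = λ _ → double≢odd (2 ^ s) (suc x) (trans (*-comm (2 ^ s) 2) (sym P+2≡N))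

-- P + 1 = N: t(N) = 1 but t(3N + N + 1) = t(4N + 1) = 0.
at-N : ∀ s P → suc P ≡ 2 ^ suc s → tm (suc P) ≢ tm (3 * 2 ^ suc s + suc (suc P))
at-N s P P+1≡N eq = true≢false (trans (sym letter-N) (trans eq letter-4N+1))
  where
  N : ℕ
  N = 2 ^ suc s
  true≢false : true ≢ false
  true≢false ()
  letter-N : tm (suc P) ≡ true
  letter-N = trans (cong tm (trans P+1≡N (sym (trans (+-identityʳ _) (*-identityˡ N)))))
                   (tm-shift (suc s) 1 0 (m^n>0 2 (suc s)))
  move : ∀ N → 3 * N + suc N ≡ 4 * N + 1
  move = solve-∀
  letter-4N+1 : tm (3 * N + suc (suc P)) ≡ false
  letter-4N+1 = trans (cong tm (trans (cong (λ x → 3 * N + suc x) P+1≡N) (move N)))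
                      (tm-shift (suc s) 4 1 (*-monoʳ-≤ 2 (m^n>0 2 s)))

-- P = N + i: blocks 1 and 4 of length N are the complement of block 0, so
-- complementing both sides of the two agreements gives a cube at i.
beyond-N : ∀ s i → 2 ^ suc s + i + 3 ≤ 2 * 2 ^ suc s →
  tm (2 ^ suc s + i) ≡ tm (3 * 2 ^ suc s + suc (2 ^ suc s + i)) →
  tm (suc (2 ^ suc s + i)) ≡ tm (3 * 2 ^ suc s + suc (suc (2 ^ suc s + i))) → ⊥
beyond-N s i P+3≤2N eq₀ eq₁ = no-cube i first second
  where
  N : ℕ
  N = 2 ^ suc s
  double : ∀ N → 2 * N ≡ N + N
  double = solve-∀
  i+3≤N : i + 3 ≤ N
  i+3≤N = +-cancelˡ-≤ N (i + 3) N (≤-trans (≤-reflexive (sym (+-assoc N i 3))) (≤-trans P+3≤2N (≤-reflexive (double N))))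
  i+2<N : suc (suc i) < N
  i+2<N = ≤-trans (≤-reflexive (+-comm 3 i)) i+3≤N
  i+1<N : suc i < N
  i+1<N = <-trans (n<1+n (suc i)) i+2<N
  block-1 : ∀ x → x < N → tm (N + x) ≡ not (tm x)
  block-1 x x<N = trans (cong (λ y → tm (y + x)) (sym (*-identityˡ N))) (tm-shift (suc s) 1 x x<N)
  block-4 : ∀ x → x < N → tm (4 * N + x) ≡ not (tm x)
  block-4 = tm-shift (suc s) 4
  move : ∀ N x → 3 * N + suc (N + x) ≡ 4 * N + suc x
  move = solve-∀
  first : tm i ≡ tm (suc i)
  first = not-injective (begin
    not (tm i)               ≡⟨ sym (block-1 i (<-trans (n<1+n i) i+1<N)) ⟩
    tm (N + i)               ≡⟨ eq₀ ⟩
    tm (3 * N + suc (N + i)) ≡⟨ cong tm (move N i) ⟩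
    tm (4 * N + suc i)       ≡⟨ block-4 (suc i) i+1<N ⟩
    not (tm (suc i))         ∎)
    where open ≡-Reasoning
  second : tm (suc i) ≡ tm (suc (suc i))
  second = not-injective (begin
    not (tm (suc i))               ≡⟨ sym (block-1 (suc i) i+1<N) ⟩
    tm (N + suc i)                 ≡⟨ cong tm (+-suc N i) ⟩
    tm (suc (N + i))               ≡⟨ eq₁ ⟩
    tm (3 * N + suc (suc (N + i))) ≡⟨ cong (λ y → tm (3 * N + suc y)) (sym (+-suc N i)) ⟩
    tm (3 * N + suc (N + suc i))   ≡⟨ cong tm (move N (suc i)) ⟩
    tm (4 * N + suc (suc i))       ≡⟨ block-4 (suc (suc i)) i+2<N ⟩
    not (tm (suc (suc i)))         ∎)
    where open ≡-Reasoning

-- For N = 2^(s+1), the pair of letters at P with P + 3 ≤ 2N does not recur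
-- at distance 3N + 1. Block 3 of length N equals block 0, so if P + 2 < N
-- the recurrence t(P) t(P+1) = t(3N+P+1) t(3N+P+2) is a cube at P; the
-- remaining positions are handled by before-N, at-N and beyond-N.
no-recurrence-3N+1 : ∀ s P → P + 3 ≤ 2 * 2 ^ suc s →
  tm P ≡ tm (3 * 2 ^ suc s + suc P) → tm (suc P) ≡ tm (3 * 2 ^ suc s + suc (suc P)) → ⊥
no-recurrence-3N+1 s P P+3≤2N eq₀ eq₁ with <-cmp (suc P) (2 ^ suc s)
... | tri< P+1<N _ _ with m≤n⇒m<n∨m≡n P+1<N
...   | inj₁ P+2<N = no-cube P (trans eq₀ (tm-shift (suc s) 3 (suc P) P+1<N))
                               (trans eq₁ (tm-shift (suc s) 3 (suc (suc P)) P+2<N))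
...   | inj₂ P+2≡N = before-N s P P+2≡N (trans eq₀ (tm-shift (suc s) 3 (suc P) P+1<N))
no-recurrence-3N+1 s P P+3≤2N eq₀ eq₁ | tri≈ _ P+1≡N _ = at-N s P P+1≡N eq₁
no-recurrence-3N+1 s P P+3≤2N eq₀ eq₁ | tri> _ _ N<P+1 with m≤n⇒∃[o]m+o≡n (≤-pred N<P+1)
... | i , refl = beyond-N s i P+3≤2N eq₀ eq₁

no-agreement-at-3N+1 : ∀ s P → P + 3 ≤ 2 * 2 ^ suc s → Agree P (P + (3 * 2 ^ suc s + 1)) 2 → ⊥
no-agreement-at-3N+1 s P P+3≤2N agr = no-recurrence-3N+1 s P P+3≤2N
  (trans (agr 0 (s≤s z≤n)) (cong tm (move P N)))
  (trans (agr 1 (s≤s (s≤s z≤n))) (cong tm (trans (cong suc (move P N)) (sym (+-suc (3 * N) (suc P))))))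
  where
  N : ℕ
  N = 2 ^ suc s
  move : ∀ P N → P + (3 * N + 1) ≡ 3 * N + suc P
  move = solve-∀

RepetitionFree : ℕ → ℕ → Set
RepetitionFree m B = ∀ p d → Agree p (p + suc d * m) m → p + suc d * m + m ≤ B → ⊥

blocks-agree : ∀ j m a b → block j m a ≡ block j m b → Agree (j + a * m) (j + b * m) m
blocks-agree j m a b eq i i<m = begin
  tm (i + (j + a * m))          ≡⟨ cong tm (+-comm i _) ⟩
  tm (j + a * m + i)            ≡⟨ letter a ⟨
  lookup (block j m a) position ≡⟨ cong (λ v → lookup v position) eq ⟩
  lookup (block j m b) position ≡⟨ letter b ⟩
  tm (j + b * m + i)            ≡⟨ cong tm (+-comm _ i) ⟩
  tm (i + (j + b * m))          ∎
  where
  open ≡-Reasoning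
  position : Fin m
  position = fromℕ< i<m
  letter : ∀ c → lookup (block j m c) position ≡ tm (j + c * m + i)
  letter c = trans (lookup∘tabulate _ position) (cong (λ x → tm (j + c * m + x)) (toℕ-fromℕ< i<m))

distinct-blocks : ∀ {m B} j k a b → RepetitionFree m B → k * m + j ≤ B → a < b → b < k →
  block j m a ≢ block j m b
distinct-blocks {m} {B} j k a b free km+j≤B a<b b<k eq with m≤n⇒∃[o]m+o≡n a<b
... | d , refl = free (j + a * m) d
  (subst (λ q → Agree (j + a * m) q m) (later-position j a d m) (blocks-agree j m a (suc a + d) eq))
  (begin
    j + a * m + suc d * m + m ≡⟨ end-position j a d m ⟩
    suc (suc a + d) * m + j   ≤⟨ +-monoˡ-≤ j (*-monoˡ-≤ m b<k) ⟩
    k * m + j                 ≤⟨ km+j≤B ⟩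
    B                         ∎)
  where
  open ≤-Reasoning
  later-position : ∀ j a d m → j + (suc a + d) * m ≡ j + a * m + suc d * m
  later-position = solve-∀
  end-position : ∀ j a d m → j + a * m + suc d * m + m ≡ suc (suc a + d) * m + j
  end-position = solve-∀

anti-power : ∀ {m B} j k → RepetitionFree m B → k * m + j ≤ B → IsAntiPower j m k
anti-power j k free km+j≤B a b a<k b<k a≢b eq with <-cmp a b
... | tri< a<b _ _ = distinct-blocks j k a b free km+j≤B a<b b<k eq
... | tri≈ _ a≡b _ = a≢b a≡b
... | tri> _ _ b<a = distinct-blocks j k b a free km+j≤B b<a a<k (sym eq)

frakK-bound : ∀ {m B} j k → RepetitionFree m B → IsFrakK j m k → B < k * m + j
frakK-bound {m} {B} j k free (_ , not-anti-power , _) with B <? k * m + j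
... | yes B<km+j = B<km+j
... | no  B≮km+j = ⊥-elim (not-anti-power (anti-power j k free (≮⇒≥ B≮km+j)))

repetition-end : ∀ m N P e {p d} → suc d ≡ N * e → N * P ≤ p →
  N * P + N * e * m + m ≤ p + suc d * m + m
repetition-end m N P e suc-d≡Ne NP≤p = +-monoˡ-≤ m (+-mono-≤ NP≤p (≤-reflexive (cong (_* m) (sym suc-d≡Ne))))

-- Part 1 (m = 3N + 1, B = 10N²): a distance of at least 4N·m overshoots B ...
far₁ : ∀ N x e → N * N * 10 < N * x + N * (suc (suc e) * 2) * (3 * N + 1) + (3 * N + 1)
far₁ N x e = ≤-trans (s≤s (m≤m+n (N * N * 10) _)) (≤-reflexive (sym (expand N x e)))
  where
  expand : ∀ N x e → N * x + N * (suc (suc e) * 2) * (3 * N + 1) + (3 * N + 1)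
                   ≡ suc (N * N * 10 + (N * N * 2 + N * 7 + N * x + N * (e * 2) * (3 * N + 1)))
  expand = solve-∀

-- ... and so does a distance 2N·m starting at a position 2N·a with 2N ≤ a + 2.
late₁ : ∀ N a → 2 * N ≤ a + 2 → N * N * 10 < N * (a * 2) + N * (1 * 2) * (3 * N + 1) + (3 * N + 1)
late₁ N a 2N≤a+2 = +-cancelʳ-< (N * 4) (N * N * 10) _ (begin-strict
  N * N * 10 + N * 4                           <⟨ m<m+n _ (s≤s z≤n) ⟩
  N * N * 10 + N * 4 + suc N                   ≡⟨ regroup N ⟩
  N * (2 * N * 2) + (N * N * 6 + N * 5 + 1)    ≤⟨ +-monoˡ-≤ _ (*-monoʳ-≤ N (*-monoˡ-≤ 2 2N≤a+2)) ⟩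
  N * ((a + 2) * 2) + (N * N * 6 + N * 5 + 1)  ≡⟨ expand N a ⟩
  N * (a * 2) + N * (1 * 2) * (3 * N + 1) + (3 * N + 1) + N * 4 ∎)
  where
  open ≤-Reasoning
  regroup : ∀ N → N * N * 10 + N * 4 + suc N ≡ N * (2 * N * 2) + (N * N * 6 + N * 5 + 1)
  regroup = solve-∀
  expand : ∀ N a → N * ((a + 2) * 2) + (N * N * 6 + N * 5 + 1)
                 ≡ N * (a * 2) + N * (1 * 2) * (3 * N + 1) + (3 * N + 1) + N * 4
  expand = solve-∀

-- Part 2 (m = 2N + 3, B = 4N²): a distance of at least 2N·m overshoots B ...
far₂ : ∀ N P e → N * N * 4 < N * P + N * suc (suc e) * (2 * N + 3) + (2 * N + 3)
far₂ N P e = ≤-trans (s≤s (m≤m+n (N * N * 4) _)) (≤-reflexive (sym (expand N P e)))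
  where
  expand : ∀ N P e → N * P + N * suc (suc e) * (2 * N + 3) + (2 * N + 3)
                   ≡ suc (N * N * 4 + (N * 8 + 2 + N * P + N * e * (2 * N + 3)))
  expand = solve-∀

-- ... and so does a distance N·m starting at a position N·P with 2N ≤ P + 5.
late₂ : ∀ N P → 2 * N ≤ P + 5 → N * N * 4 < N * P + N * 1 * (2 * N + 3) + (2 * N + 3)
late₂ N P 2N≤P+5 = +-cancelʳ-< (N * 5) (N * N * 4) _ (begin-strict
  N * N * 4 + N * 5                        <⟨ m<m+n _ (s≤s z≤n) ⟩
  N * N * 4 + N * 5 + 3                    ≡⟨ regroup N ⟩
  N * (2 * N) + (N * N * 2 + N * 5 + 3)    ≤⟨ +-monoˡ-≤ _ (*-monoʳ-≤ N 2N≤P+5) ⟩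
  N * (P + 5) + (N * N * 2 + N * 5 + 3)    ≡⟨ expand N P ⟩
  N * P + N * 1 * (2 * N + 3) + (2 * N + 3) + N * 5 ∎)
  where
  open ≤-Reasoning
  regroup : ∀ N → N * N * 4 + N * 5 + 3 ≡ N * (2 * N) + (N * N * 2 + N * 5 + 3)
  regroup = solve-∀
  expand : ∀ N P → N * (P + 5) + (N * N * 2 + N * 5 + 3) ≡ N * P + N * 1 * (2 * N + 3) + (2 * N + 3) + N * 5
  expand = solve-∀

-- Part 1. After desubstitution the distance is e′·m with 2N·e′ = d + 1:
-- e′ = 0 is impossible, e′ ≥ 2 overshoots, and for e′ = 1 the position a
-- either is small (no agreement at distance 3N + 1) or overshoots.
short-distance₁ : ∀ s p d a e′ → suc d ≡ 2 ^ suc s * (e′ * 2) → 2 ^ suc s * (a * 2) ≤ p →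
  p + suc d * (3 * 2 ^ suc s + 1) + (3 * 2 ^ suc s + 1) ≤ 2 ^ suc s * 2 ^ suc s * 10 →
  Agree a (a + e′ * (3 * 2 ^ suc s + 1)) 2 → ⊥
short-distance₁ s p d a zero suc-d≡Ne _ _ _ = 1+n≢0 (trans suc-d≡Ne (*-zeroʳ (2 ^ suc s)))
short-distance₁ s p d a (suc zero) suc-d≡Ne Na≤p fits agr with a + 3 ≤? 2 * 2 ^ suc s
... | yes a+3≤2N = no-agreement-at-3N+1 s a a+3≤2N
      (subst (λ D → Agree a (a + D) 2) (*-identityˡ (3 * 2 ^ suc s + 1)) agr)
... | no  a+3≰2N = <⇒≱ (late₁ (2 ^ suc s) a (≤-pred (≤-trans (≰⇒> a+3≰2N) (≤-reflexive (+-suc a 2)))))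
      (≤-trans (repetition-end (3 * 2 ^ suc s + 1) (2 ^ suc s) (a * 2) (1 * 2) suc-d≡Ne Na≤p) fits)
short-distance₁ s p d a (suc (suc e)) suc-d≡Ne Na≤p fits agr = <⇒≱ (far₁ (2 ^ suc s) (a * 2) e)
  (≤-trans (repetition-end (3 * 2 ^ suc s + 1) (2 ^ suc s) (a * 2) (suc (suc e) * 2) suc-d≡Ne Na≤p) fits)

-- m = 3N + 1 with N = 2^(s+1) is odd; desubstitute s + 1 times, from length
-- 3N + 1 down to length 4, and once more down to length 2.
3N+1-odd : ∀ X → 3 * (2 * X) + 1 ≡ suc (3 * X * 2)
3N+1-odd = solve-∀

repetition-free₁ : ∀ s → RepetitionFree (3 * 2 ^ suc s + 1) (2 ^ suc s * 2 ^ suc s * 10)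
repetition-free₁ s p d agr fits =
  let (P , e , suc-d≡Ne , NP≤p , agr′) = iterate (suc s) {3} (s≤s (s≤s z≤n)) p (suc d) (3 * 2 ^ s) odd-form
      (a , e′ , e≡e′*2 , a*2≤P , agr″) = halve-multiple {K = 2} P e (3 * 2 ^ s) ≤-refl (n≤1+n 4) agr′
  in short-distance₁ s p d a e′ (trans suc-d≡Ne (cong (2 ^ suc s *_) e≡e′*2)) (≤-trans (*-monoʳ-≤ (2 ^ suc s) a*2≤P) NP≤p) fits
       (subst (λ m → Agree a (a + e′ * m) 2) (sym (3N+1-odd (2 ^ s))) agr″)
  where
  odd-form : Agree p (p + suc d * suc (3 * 2 ^ s * 2)) (2 ^ suc s * 3 + 1)
  odd-form = agree-≤ (≤-reflexive (cong (_+ 1) (*-comm (2 ^ suc s) 3)))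
    (subst (λ m → Agree p (p + suc d * m) (3 * 2 ^ suc s + 1)) (3N+1-odd (2 ^ s)) agr)

-- Part 2. After desubstitution the distance is e·m with N·e = d + 1: e = 0 is
-- impossible, e ≥ 2 overshoots, and for e = 1 the desubstituted position P
-- either is small (no agreement at distance 2N + 3) or overshoots.
short-distance₂ : ∀ s p d P e → suc d ≡ 2 ^ suc s * e → 2 ^ suc s * P ≤ p →
  p + suc d * (2 * 2 ^ suc s + 3) + (2 * 2 ^ suc s + 3) ≤ 2 ^ suc s * 2 ^ suc s * 4 →
  Agree P (P + e * (2 * 2 ^ suc s + 3)) 3 → ⊥
short-distance₂ s p d P zero suc-d≡Ne _ _ _ = 1+n≢0 (trans suc-d≡Ne (*-zeroʳ (2 ^ suc s)))
short-distance₂ s p d P (suc zero) suc-d≡Ne NP≤p fits agr with P + 6 ≤? 2 * 2 ^ suc s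
... | yes P+6≤2N = no-agreement-at-M+3 (suc (suc s)) P P+6≤2N
      (subst (λ D → Agree P (P + D) 3) (*-identityˡ (2 * 2 ^ suc s + 3)) agr)
... | no  P+6≰2N = <⇒≱ (late₂ (2 ^ suc s) P (≤-pred (≤-trans (≰⇒> P+6≰2N) (≤-reflexive (+-suc P 5)))))
      (≤-trans (repetition-end (2 * 2 ^ suc s + 3) (2 ^ suc s) P 1 suc-d≡Ne NP≤p) fits)
short-distance₂ s p d P (suc (suc e)) suc-d≡Ne NP≤p fits agr = <⇒≱ (far₂ (2 ^ suc s) P e)
  (≤-trans (repetition-end (2 * 2 ^ suc s + 3) (2 ^ suc s) P (suc (suc e)) suc-d≡Ne NP≤p) fits)

-- m = 2N + 3 with N = 2^(s+1) is odd; desubstitute s + 1 times, from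
-- length 2N + 1 down to length 3.
2N+3-odd : ∀ N → 2 * N + 3 ≡ suc ((N + 1) * 2)
2N+3-odd = solve-∀

repetition-free₂ : ∀ s → RepetitionFree (2 * 2 ^ suc s + 3) (2 ^ suc s * 2 ^ suc s * 4)
repetition-free₂ s p d agr fits =
  let (P , e , suc-d≡Ne , NP≤p , agr′) = iterate (suc s) {2} ≤-refl p (suc d) (2 ^ suc s + 1) odd-form
  in short-distance₂ s p d P e suc-d≡Ne NP≤p fits
       (subst (λ m → Agree P (P + e * m) 3) (sym (2N+3-odd (2 ^ suc s))) agr′)
  where
  odd-form : Agree p (p + suc d * suc ((2 ^ suc s + 1) * 2)) (2 ^ suc s * 2 + 1)
  odd-form = agree-≤ (+-mono-≤ (≤-reflexive (*-comm (2 ^ suc s) 2)) (s≤s z≤n))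
    (subst (λ m → Agree p (p + suc d * m) (2 * 2 ^ suc s + 3)) (2N+3-odd (2 ^ suc s)) agr)

-- The bounds of the theorem, for ℓ = s + 3 and N = 2^(s+1):
-- 5·2^(2ℓ-3) = 10N² and 2^(2ℓ-2) = 4N².
power-split : ∀ s k → 2 ^ (suc s + suc s + k) ≡ 2 ^ suc s * 2 ^ suc s * 2 ^ k
power-split s k = trans (^-distribˡ-+-* 2 (suc s + suc s) k) (cong (_* 2 ^ k) (^-distribˡ-+-* 2 (suc s) (suc s)))

bound₁ : ∀ s → 5 * 2 ^ (2 * (3 + s) ∸ 3) ≡ 2 ^ suc s * 2 ^ suc s * 10
bound₁ s = begin
  5 * 2 ^ (2 * (3 + s) ∸ 3)   ≡⟨ cong (λ x → 5 * 2 ^ x) (exponent s) ⟩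
  5 * 2 ^ (suc s + suc s + 1) ≡⟨ cong (5 *_) (power-split s 1) ⟩
  5 * (N * N * 2)             ≡⟨ regroup N ⟩
  N * N * 10                  ∎
  where
  open ≡-Reasoning
  N : ℕ
  N = 2 ^ suc s
  exponent : ∀ s → s + suc (suc (suc (s + 0))) ≡ suc s + suc s + 1
  exponent = solve-∀
  regroup : ∀ N → 5 * (N * N * 2) ≡ N * N * 10
  regroup = solve-∀

bound₂ : ∀ s → 2 ^ (2 * (3 + s) ∸ 2) ≡ 2 ^ suc s * 2 ^ suc s * 4
bound₂ s = trans (cong (2 ^_) (exponent s)) (power-split s 2)
  where
  exponent : ∀ s → suc (s + suc (suc (suc (s + 0)))) ≡ suc s + suc s + 2
  exponent = solve-∀

mainTheorem18 : (ℓ j : ℕ) → 3 ≤ ℓ →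
    (∀ k → IsFrakK j (3 * 2 ^ (ℓ ∸ 2) + 1) k →
       5 * 2 ^ (2 * ℓ ∸ 3) < k * (3 * 2 ^ (ℓ ∸ 2) + 1) + j)
    × (∀ k → IsFrakK j (2 ^ (ℓ ∸ 1) + 3) k →
       2 ^ (2 * ℓ ∸ 2) < k * (2 ^ (ℓ ∸ 1) + 3) + j)
mainTheorem18 (suc (suc (suc s))) j _ =
  (λ k frak → subst (_< k * (3 * 2 ^ suc s + 1) + j) (sym (bound₁ s))
                (frakK-bound j k (repetition-free₁ s) frak)) ,
  (λ k frak → subst (_< k * (2 * 2 ^ suc s + 3) + j) (sym (bound₂ s))
                (frakK-bound j k (repetition-free₂ s) frak))
mainTheorem18 zero                j ()
mainTheorem18 (suc zero)          j (s≤s ())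
mainTheorem18 (suc (suc zero))    j (s≤s (s≤s ()))
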